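{- Let $G=(V,E^+,E^-)$ be a signed graph and let $v\in V$ be a vertex such that $v\in\partial S$ for some offensive alliance $S$ of $G$. Then $\deg^-(v)\geq \left\lceil\frac{\deg^+(v)+1}{2}\right\rceil$.
   Context: A signed graph is a triple $G=(V,E^+,E^-)$ with $V$ finite, $E^+,E^-\subseteq\binom{V}{2}$ and $E^+\cap E^-=\emptyset$. $N^+(v)=\{u: uv\in E^+\}$, $N^-(v)=\{u: uv\in E^-\}$, $N(v)=N^+(v)\cup N^-(v)$; $\deg^+(v)=|N^+(v)|$, $\deg^-(v)=|N^-(v)|$. For $X\subseteq V$, $\deg^+_X(v)=|N^+(v)\cap X|$, $\deg^-_X(v)=|N^-(v)\cap X|$, $\overline{X}=V\setminus X$. For $S\subseteq V$, $\partial S=\left(\bigcup_{u\in S}N(u)\right)\setminus S$. A set $S\subseteq V$ is an offensive alliance if for every $w\in\partial S$: (1) $\deg^-_S(w)\geq \deg^+_S(w)$ and (2) $\deg^-_S(w)\geq \deg^+_{\overline S}(w)+1$. -}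

module Defs where

import Data.Empty

open import Data.Nat using (ℕ)
open import Data.Bool using (Bool; true; false; _∧_; _∨_; not; T)
open import Data.Fin using (Fin)
open import Data.Fin.Subset using (Subset; ∣_∣; _∩_; _∈_; _∉_; ∁)
open import Data.Vec using (tabulate)
open import Data.Product using (Σ; _×_)
open import Relation.Binary.PropositionalEquality using (_≡_)
open import Data.Nat using (_≥_; suc)

-- E⁺ and E⁻ are given as
-- Boolean adjacency functions; an edge set ⊆ (V choose 2) means the
-- relation is symmetric and irreflexive.
record SignedGraph (n : ℕ) : Set where
  field
    pos  : Fin n → Fin n → Bool
    neg  : Fin n → Fin n → Bool
    pos-sym   : ∀ u v → pos u v ≡ pos v u
    neg-sym   : ∀ u v → neg u v ≡ neg v u
    pos-irrefl : ∀ v → pos v v ≡ false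
    neg-irrefl : ∀ v → neg v v ≡ false
    disjoint  : ∀ u v → T (pos u v) → T (neg u v) → Data.Empty.⊥

open SignedGraph public

module _ {n : ℕ} (G : SignedGraph n) where

  N⁺ : Fin n → Subset n
  N⁺ v = tabulate (λ u → pos G v u)

  N⁻ : Fin n → Subset n
  N⁻ v = tabulate (λ u → neg G v u)

  N : Fin n → Subset n
  N v = tabulate (λ u → pos G v u ∨ neg G v u)

  deg⁺ : Fin n → ℕ
  deg⁺ v = ∣ N⁺ v ∣

  deg⁻ : Fin n → ℕ
  deg⁻ v = ∣ N⁻ v ∣

  deg⁺[_] : Subset n → Fin n → ℕ
  deg⁺[ X ] v = ∣ N⁺ v ∩ X ∣

  deg⁻[_] : Subset n → Fin n → ℕ
  deg⁻[ X ] v = ∣ N⁻ v ∩ X ∣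

  _∈∂_ : Fin n → Subset n → Set
  w ∈∂ S = (w ∉ S) × Σ (Fin n) (λ u → (u ∈ S) × (w ∈ N u))

  IsOffensiveAlliance : Subset n → Set
  IsOffensiveAlliance S =
    ∀ w → w ∈∂ S →
      (deg⁻[ S ] w ≥ deg⁺[ S ] w) × (deg⁻[ S ] w ≥ suc (deg⁺[ ∁ S ] w))

-- A boundary vertex v of an offensive alliance S satisfies deg⁻_S(v) ≥ deg⁺_S(v) and
-- deg⁻_S(v) ≥ deg⁺_{S̄}(v) + 1; adding them gives deg⁺(v) + 1 ≤ 2 deg⁻_S(v) ≤ 2 deg⁻(v).
module Submission where

open import Defs
open import Data.Nat using (ℕ; _≥_; _≤_; _+_; suc; ⌈_/2⌉)
open import Data.Nat.Properties using (+-suc; +-mono-≤; ≤-trans; ≤-reflexive; ⌈n/2⌉-mono; n≡⌈n+n/2⌉; module ≤-Reasoning)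
open import Data.Fin using (Fin)
open import Data.Fin.Subset using (Subset; ∣_∣; _∩_; ∁; inside; outside)
open import Data.Fin.Subset.Properties using (∣p∩q∣≤∣p∣)
open import Data.Product using (Σ; _×_; _,_; proj₁; proj₂)
open import Data.Vec using ([]; _∷_)
open import Relation.Binary.PropositionalEquality using (_≡_; refl; cong; sym; trans)

∣p∩q∣+∣p∩∁q∣≡∣p∣ : ∀ {n} (p q : Subset n) → ∣ p ∩ q ∣ + ∣ p ∩ ∁ q ∣ ≡ ∣ p ∣
∣p∩q∣+∣p∩∁q∣≡∣p∣ []            []            = refl
∣p∩q∣+∣p∩∁q∣≡∣p∣ (outside ∷ p) (_ ∷ q)       = ∣p∩q∣+∣p∩∁q∣≡∣p∣ p q
∣p∩q∣+∣p∩∁q∣≡∣p∣ (inside ∷ p)  (inside ∷ q)  = cong suc (∣p∩q∣+∣p∩∁q∣≡∣p∣ p q)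
∣p∩q∣+∣p∩∁q∣≡∣p∣ (inside ∷ p)  (outside ∷ q) =
  trans (+-suc ∣ p ∩ q ∣ ∣ p ∩ ∁ q ∣) (cong suc (∣p∩q∣+∣p∩∁q∣≡∣p∣ p q))

m≤n+n⇒⌈m/2⌉≤n : ∀ {m n} → m ≤ n + n → ⌈ m /2⌉ ≤ n
m≤n+n⇒⌈m/2⌉≤n {n = n} m≤n+n = ≤-trans (⌈n/2⌉-mono m≤n+n) (≤-reflexive (sym (n≡⌈n+n/2⌉ n)))

module _ {n : ℕ} (G : SignedGraph n) where

  deg⁺[S]+deg⁺[∁S]≡deg⁺ : ∀ S v → deg⁺[_] G S v + deg⁺[_] G (∁ S) v ≡ deg⁺ G v
  deg⁺[S]+deg⁺[∁S]≡deg⁺ S v = ∣p∩q∣+∣p∩∁q∣≡∣p∣ (N⁺ G v) S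

  deg⁻[S]≤deg⁻ : ∀ S v → deg⁻[_] G S v ≤ deg⁻ G v
  deg⁻[S]≤deg⁻ S v = ∣p∩q∣≤∣p∣ (N⁻ G v) S

  suc-deg⁺≤deg⁻[S]+deg⁻[S] : ∀ {S v} → IsOffensiveAlliance G S → _∈∂_ G v S →
                             suc (deg⁺ G v) ≤ deg⁻[_] G S v + deg⁻[_] G S v
  suc-deg⁺≤deg⁻[S]+deg⁻[S] {S} {v} alliance v∈∂S = begin
    suc (deg⁺ G v)                                    ≡⟨ cong suc (sym (deg⁺[S]+deg⁺[∁S]≡deg⁺ S v)) ⟩
    suc (deg⁺[_] G S v + deg⁺[_] G (∁ S) v)           ≡⟨ sym (+-suc (deg⁺[_] G S v) _) ⟩
    deg⁺[_] G S v + suc (deg⁺[_] G (∁ S) v)           ≤⟨ +-mono-≤ deg⁺[S]≤deg⁻[S] deg⁺[∁S]<deg⁻[S] ⟩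
    deg⁻[_] G S v + deg⁻[_] G S v                     ∎
    where
    open ≤-Reasoning
    deg⁺[S]≤deg⁻[S] : deg⁺[_] G S v ≤ deg⁻[_] G S v
    deg⁺[S]≤deg⁻[S] = proj₁ (alliance v v∈∂S)
    deg⁺[∁S]<deg⁻[S] : suc (deg⁺[_] G (∁ S) v) ≤ deg⁻[_] G S v
    deg⁺[∁S]<deg⁻[S] = proj₂ (alliance v v∈∂S)

corollary1 : {n : ℕ} (G : SignedGraph n) (v : Fin n) →
    Σ (Subset n) (λ S → IsOffensiveAlliance G S × _∈∂_ G v S) →
    deg⁻ G v ≥ ⌈ suc (deg⁺ G v) /2⌉
corollary1 G v (S , alliance , v∈∂S) =
  ≤-trans (m≤n+n⇒⌈m/2⌉≤n (suc-deg⁺≤deg⁻[S]+deg⁻[S] G alliance v∈∂S))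
          (deg⁻[S]≤deg⁻ G S v)
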